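{- Let $K(A,B)=K(m,n)$ be a complete bipartite graph whose edges are colored with two colors, blue and green. Then $K(A,B)$ has a monochromatic spanning tree if and only if $K(A,B)$ is neither an $S$-type graph nor an $M$-type graph.
   Context: $K(A,B)$ denotes the complete bipartite graph with partite sets $A$, $B$ (nonempty). Its edges are colored blue or green. $K(A,B)$ is an $M$-type graph if there are partitions $A=A_1\cup A_2$, $B=B_1\cup B_2$ with all $A_i,B_i$ nonempty such that all edges between $A_1$ and $B_1$ and all edges between $A_2$ and $B_2$ are blue, while all edges between $A_1$ and $B_2$ and all edges between $A_2$ and $B_1$ are green. Let $X(G)$ be the set of vertices all of whose incident edges are blue and $Y(G)$ the set of vertices all of whose incident edges are green. $K(A,B)$ is an $S$-type graph if $X(G)\neq\emptyset$ and $Y(G)\neq\emptyset$. -}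

module Defs where

open import Data.Nat using (ℕ; _≤_)
open import Data.Fin using (Fin)
open import Data.Empty using (⊥)
open import Data.Bool using (Bool; true; false)
open import Data.Sum using (_⊎_; inj₁; inj₂)
open import Data.Product using (Σ; ∃; ∃-syntax; _×_)
open import Data.List using (List; []; _∷_; _++_; length; [_])
open import Data.List.Relation.Unary.Unique.Propositional using (Unique)
open import Data.List.Relation.Unary.Linked using (Linked)
open import Relation.Binary.PropositionalEquality using (_≡_; _≢_)

data Colour : Set where
  blue green : Colour

Colouring : ℕ → ℕ → Set
Colouring m n = Fin m → Fin n → Colour

Vertex : ℕ → ℕ → Set
Vertex m n = Fin m ⊎ Fin n

-- A set of edges of K(A,B) (a spanning subgraph): T a b ≡ true iff edge ab is in it.
EdgeSet : ℕ → ℕ → Set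
EdgeSet m n = Fin m → Fin n → Bool

data Adj {m n : ℕ} (T : EdgeSet m n) : Vertex m n → Vertex m n → Set where
  ab : ∀ {a b} → T a b ≡ true → Adj T (inj₁ a) (inj₂ b)
  ba : ∀ {a b} → T a b ≡ true → Adj T (inj₂ b) (inj₁ a)

data Walk {m n : ℕ} (T : EdgeSet m n) : Vertex m n → Vertex m n → Set where
  here : ∀ {v} → Walk T v v
  step : ∀ {u v w} → Adj T u v → Walk T v w → Walk T u w

Connected : ∀ {m n} → EdgeSet m n → Set
Connected T = ∀ u v → Walk T u v

HasCycle : ∀ {m n} → EdgeSet m n → Set
HasCycle {m} {n} T =
  Σ (Vertex m n) λ v₀ → Σ (List (Vertex m n)) λ rest →
    (2 ≤ length rest) × Unique (v₀ ∷ rest) × Linked (Adj T) (v₀ ∷ rest ++ [ v₀ ])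

Acyclic : ∀ {m n} → EdgeSet m n → Set
Acyclic T = HasCycle T → ⊥

IsSpanningTree : ∀ {m n} → EdgeSet m n → Set
IsSpanningTree T = Connected T × Acyclic T

Monochromatic : ∀ {m n} → Colouring m n → Colour → EdgeSet m n → Set
Monochromatic c k T = ∀ a b → T a b ≡ true → c a b ≡ k

HasMonochromaticSpanningTree : ∀ {m n} → Colouring m n → Set
HasMonochromaticSpanningTree {m} {n} c =
  ∃[ k ] ∃[ T ] (IsSpanningTree {m} {n} T × Monochromatic c k T)

-- M-type: partitions A = A₁ ∪ A₂, B = B₁ ∪ B₂ (encoded by Boolean labels,
-- true = part 1, false = part 2), all parts nonempty, with edges inside
-- A₁–B₁ and A₂–B₂ blue and edges A₁–B₂, A₂–B₁ green.
MType : ∀ {m n} → Colouring m n → Set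
MType {m} {n} c =
  Σ (Fin m → Bool) λ pA → Σ (Fin n → Bool) λ pB →
    (∃[ a ] pA a ≡ true) × (∃[ a ] pA a ≡ false) ×
    (∃[ b ] pB b ≡ true) × (∃[ b ] pB b ≡ false) ×
    (∀ a b → pA a ≡ pB b → c a b ≡ blue) ×
    (∀ a b → pA a ≢ pB b → c a b ≡ green)

-- v ∈ X(G) (k = blue) / v ∈ Y(G) (k = green): all edges incident to v have colour k.
AllIncident : ∀ {m n} → Colouring m n → Colour → Vertex m n → Set
AllIncident c k (inj₁ a) = ∀ b → c a b ≡ k
AllIncident c k (inj₂ b) = ∀ a → c a b ≡ k

SType : ∀ {m n} → Colouring m n → Set
SType {m} {n} c =
  (∃[ v ] AllIncident {m} {n} c blue v) × (∃[ v ] AllIncident {m} {n} c green v)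

module Submission where

-- Necessity: a tree of colour k gives every vertex an edge of colour k, so no
-- vertex has all its edges of the other colour; and an M-type partition
-- induces a labelling that is constant along k-edges, yet the tree joins A₁
-- to A₂.  Sufficiency: let C be the blue component of some a₀ ∈ A.  If C is
-- everything we are done; otherwise every edge leaving C is green, and a case
-- analysis on which of B ∩ C, A ∖ C, B ∖ C are empty shows that some green
-- component is everything unless the colouring is of S- or M-type.

open import Defs
open import Data.Nat using (ℕ; zero; suc; _≤_; _<_; _≤′_; ≤′-refl; ≤′-step; z≤n; s≤s; _+_)
open import Data.Nat.Properties
  using (≤-refl; <-trans; <-irrefl; <-≤-trans; ≤-<-trans; ≤-pred; ≤⇒≤′; n≤0⇒n≡0; ≤⇒≯;
         ≮⇒≥; +-mono-≤; +-mono-<-≤; +-mono-≤-<)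
open import Data.Fin using (Fin; zero; suc; _≟_)
open import Data.Fin.Properties using (any?; ¬∀⟶∃¬)
open import Data.Bool using (Bool; true; false; _∨_; not; if_then_else_)
open import Data.Bool.Properties using (¬-not; not-involutive) renaming (_≟_ to _≟ᵇ_)
open import Data.Sum using (_⊎_; inj₁; inj₂; swap)
open import Data.Sum.Properties using (≡-dec)
open import Data.Product using (∃; ∃-syntax; _×_; _,_; proj₁; proj₂)
open import Data.Empty using (⊥; ⊥-elim)
open import Data.Unit using (⊤; tt)
open import Data.List using (List; []; _∷_; _++_; [_])
open import Data.List.Relation.Unary.All as All using (All; _∷_)
open import Data.List.Relation.Unary.AllPairs using (_∷_)
open import Data.List.Relation.Unary.Unique.Propositional using (Unique)
open import Data.List.Relation.Unary.Linked using (Linked; _∷_)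
open import Relation.Binary.Definitions using (DecidableEquality)
open import Relation.Binary.PropositionalEquality using (_≡_; _≢_; refl; sym; trans; subst)
open import Relation.Nullary using (¬_; Dec; yes; no; does; _×-dec_; _⊎-dec_; map′; contradiction)
open import Relation.Nullary.Decidable using (dec-true)
open import Function using (_∘_)
open import Function.Bundles using (_⇔_; mk⇔)

does-sound : ∀ {P : Set} (d : Dec P) → does d ≡ true → P
does-sound (yes p) _ = p

_≟ᶜ_ : DecidableEquality Colour
blue  ≟ᶜ blue  = yes refl
green ≟ᶜ green = yes refl
blue  ≟ᶜ green = no λ ()
green ≟ᶜ blue  = no λ ()

not-blue : ∀ {k} → k ≢ blue → k ≡ green
not-blue {blue}  k≢blue = contradiction refl k≢blue
not-blue {green} _      = refl

not-green : ∀ {k} → k ≢ green → k ≡ blue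
not-green {blue}  _           = refl
not-green {green} k≢green = contradiction refl k≢green

some-green : ∀ {n} (f : Fin n → Colour) → ¬ (∀ i → f i ≡ blue) → ∃ λ i → f i ≡ green
some-green {n} f not-all-blue with ¬∀⟶∃¬ n (λ i → f i ≡ blue) (λ i → f i ≟ᶜ blue) not-all-blue
... | i , fi≢blue = i , not-blue fi≢blue

avoiding : ∀ {I : Set} (f : I → Bool) {i j} → f i ≢ f j → ∀ p → ∃ λ k → f k ≢ p
avoiding f {i} {j} fi≢fj p with f i ≟ᵇ p
... | yes refl = j , λ fj≡fi → fi≢fj (sym fj≡fi)
... | no fi≢p  = i , fi≢p

_≟ᵛ_ : ∀ {m n} → DecidableEquality (Vertex m n)
_≟ᵛ_ = ≡-dec _≟_ _≟_

any-vertex? : ∀ {m n} {P : Vertex m n → Set} → (∀ v → Dec (P v)) → Dec (∃ P)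
any-vertex? P? with any? (P? ∘ inj₁) | any? (P? ∘ inj₂)
... | yes (a , p) | _           = yes (inj₁ a , p)
... | no _        | yes (b , p) = yes (inj₂ b , p)
... | no ¬pA      | no ¬pB      = no λ { (inj₁ a , p) → ¬pA (a , p) ; (inj₂ b , p) → ¬pB (b , p) }

_⊑_ : ∀ {I : Set} → (I → Bool) → (I → Bool) → Set
S ⊑ S′ = ∀ i → S i ≡ true → S′ i ≡ true

indicator : Bool → ℕ
indicator true  = 1
indicator false = 0

indicator-≤1 : ∀ x → indicator x ≤ 1
indicator-≤1 true  = ≤-refl
indicator-≤1 false = z≤n

indicator-mono : ∀ {x y} → (x ≡ true → y ≡ true) → indicator x ≤ indicator y
indicator-mono {false} _   = z≤n
indicator-mono {true}  x⇒y rewrite x⇒y refl = ≤-refl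

count : ∀ {n} → (Fin n → Bool) → ℕ
count {zero}  _ = 0
count {suc n} S = indicator (S zero) + count (S ∘ suc)

count-≤ : ∀ {n} (S : Fin n → Bool) → count S ≤ n
count-≤ {zero}  _ = z≤n
count-≤ {suc n} S = +-mono-≤ (indicator-≤1 (S zero)) (count-≤ (S ∘ suc))

count-mono : ∀ {n} {S S′ : Fin n → Bool} → S ⊑ S′ → count S ≤ count S′
count-mono {zero}  _   = z≤n
count-mono {suc n} S⊑S′ = +-mono-≤ (indicator-mono (S⊑S′ zero)) (count-mono (S⊑S′ ∘ suc))

count-grows : ∀ {n} {S S′ : Fin n → Bool} → S ⊑ S′ →
  ∀ i → S′ i ≡ true → S i ≡ false → count S < count S′
count-grows {S = S} {S′} S⊑S′ zero S′i Si rewrite S′i | Si =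
  s≤s (count-mono {S = S ∘ suc} {S′ ∘ suc} (S⊑S′ ∘ suc))
count-grows S⊑S′ (suc i) S′i Si =
  +-mono-≤-< (indicator-mono (S⊑S′ zero)) (count-grows (S⊑S′ ∘ suc) i S′i Si)

size : ∀ {m n} → (Vertex m n → Bool) → ℕ
size S = count (S ∘ inj₁) + count (S ∘ inj₂)

size-≤ : ∀ {m n} (S : Vertex m n → Bool) → size S ≤ m + n
size-≤ S = +-mono-≤ (count-≤ (S ∘ inj₁)) (count-≤ (S ∘ inj₂))

size-grows : ∀ {m n} {S S′ : Vertex m n → Bool} → S ⊑ S′ →
  ∀ v → S′ v ≡ true → S v ≡ false → size S < size S′
size-grows S⊑S′ (inj₁ a) S′v Sv =
  +-mono-<-≤ (count-grows (S⊑S′ ∘ inj₁) a S′v Sv) (count-mono (S⊑S′ ∘ inj₂))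
size-grows S⊑S′ (inj₂ b) S′v Sv =
  +-mono-≤-< (count-mono (S⊑S′ ∘ inj₁)) (count-grows (S⊑S′ ∘ inj₂) b S′v Sv)

adj? : ∀ {m n} (E : EdgeSet m n) (u v : Vertex m n) → Dec (Adj E u v)
adj? E (inj₁ a) (inj₂ b) = map′ ab (λ { (ab p) → p }) (E a b ≟ᵇ true)
adj? E (inj₂ b) (inj₁ a) = map′ ba (λ { (ba p) → p }) (E a b ≟ᵇ true)
adj? E (inj₁ _) (inj₁ _) = no λ ()
adj? E (inj₂ _) (inj₂ _) = no λ ()

adj-sym : ∀ {m n} {E : EdgeSet m n} {u v} → Adj E u v → Adj E v u
adj-sym (ab p) = ba p
adj-sym (ba p) = ab p

adj-distinct : ∀ {m n} {E : EdgeSet m n} {u v} → Adj E u v → u ≢ v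
adj-distinct (ab _) ()
adj-distinct (ba _) ()

_▸_ : ∀ {m n} {E : EdgeSet m n} {u v w} → Walk E u v → Walk E v w → Walk E u w
here     ▸ q = q
step e p ▸ q = step e (p ▸ q)

reverse-walk : ∀ {m n} {E : EdgeSet m n} {u v} → Walk E u v → Walk E v u
reverse-walk here       = here
reverse-walk (step e p) = reverse-walk p ▸ step (adj-sym e) here

walk-invariant : ∀ {m n} {E : EdgeSet m n} {L : Set} (ℓ : Vertex m n → L) →
  (∀ {u v} → Adj E u v → ℓ u ≡ ℓ v) → ∀ {u v} → Walk E u v → ℓ u ≡ ℓ v
walk-invariant ℓ ℓ-edge here       = refl
walk-invariant ℓ ℓ-edge (step e p) = trans (ℓ-edge e) (walk-invariant ℓ ℓ-edge p)

end : ∀ {A : Set} → A → List A → A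
end x []       = x
end x (y ∷ ys) = end y ys

end-all : ∀ {A : Set} {P : A → Set} x xs → All P (x ∷ xs) → P (end x xs)
end-all x []       (px ∷ _)  = px
end-all x (y ∷ ys) (_ ∷ pys) = end-all y ys pys

last-link : ∀ {A : Set} {R : A → A → Set} x xs w → Linked R (x ∷ xs ++ [ w ]) → R (end x xs) w
last-link x []       w (r ∷ _) = r
last-link x (y ∷ ys) w (_ ∷ l) = last-link y ys w l

NonBacktracking : ∀ {A : Set} → List A → Set
NonBacktracking (x ∷ y ∷ z ∷ zs) = x ≢ z × NonBacktracking (y ∷ z ∷ zs)
NonBacktracking _                = ⊤

snoc-nonbacktracking : ∀ {A : Set} {x : A} {xs w} → Unique (x ∷ xs) → All (_≢ w) (x ∷ xs) →
  NonBacktracking (x ∷ xs ++ [ w ])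
snoc-nonbacktracking {xs = []}         _                      _          = tt
snoc-nonbacktracking {xs = _ ∷ []}     _                      (x≢w ∷ _)  = x≢w , tt
snoc-nonbacktracking {xs = _ ∷ _ ∷ _} ((_ ∷ x≢z ∷ _) ∷ uniq) (_ ∷ ≢w)   =
  x≢z , snoc-nonbacktracking uniq ≢w

cycle-nonbacktracking : ∀ {A : Set} {v₀ v₁ v₂ : A} {vs} → Unique (v₀ ∷ v₁ ∷ v₂ ∷ vs) →
  NonBacktracking (v₀ ∷ v₁ ∷ (v₂ ∷ vs) ++ [ v₀ ])
cycle-nonbacktracking (v₀≢@(_ ∷ v₀≢v₂ ∷ _) ∷ uniq) =
  v₀≢v₂ , snoc-nonbacktracking uniq (All.map (λ ne eq → ne (sym eq)) v₀≢)

-- A parent function with strictly decreasing rank away from the root r, whose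
-- steps are edges of E, defines a spanning tree T ⊆ E: every vertex reaches r
-- by following parents, and every edge of T joins a vertex to its parent.

module ParentForest {m n : ℕ} (E : EdgeSet m n) (r : Vertex m n)
  (parent : Vertex m n → Vertex m n) (rank : Vertex m n → ℕ)
  (parent-root : parent r ≡ r)
  (parent-step : ∀ v → v ≢ r → Adj E v (parent v) × rank (parent v) < rank v) where

  tree-edge? : ∀ a b → Dec (parent (inj₁ a) ≡ inj₂ b ⊎ parent (inj₂ b) ≡ inj₁ a)
  tree-edge? a b = (parent (inj₁ a) ≟ᵛ inj₂ b) ⊎-dec (parent (inj₂ b) ≟ᵛ inj₁ a)

  T : EdgeSet m n
  T a b = does (tree-edge? a b)

  T-edge : ∀ {u w} → Adj T u w → parent u ≡ w ⊎ parent w ≡ u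
  T-edge (ab p) = does-sound (tree-edge? _ _) p
  T-edge (ba p) = swap (does-sound (tree-edge? _ _) p)

  parent-edge : ∀ {u w} → parent u ≡ w → u ≢ w → Adj E u w × rank w < rank u
  parent-edge {u} refl u≢pu with u ≟ᵛ r
  ... | yes refl = ⊥-elim (u≢pu (sym parent-root))
  ... | no u≢r   = parent-step u u≢r

  up-rank : ∀ {u w} → Adj T u w → parent u ≡ w → rank w < rank u
  up-rank e pu = proj₂ (parent-edge pu (adj-distinct e))

  tree-link : ∀ {u w} → parent u ≡ w → Adj E u w → Adj T u w
  tree-link {inj₁ a} {inj₂ b} pu (ab _) = ab (dec-true (tree-edge? a b) (inj₁ pu))
  tree-link {inj₂ b} {inj₁ a} pu (ba _) = ba (dec-true (tree-edge? a b) (inj₂ pu))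

  T⊆E : ∀ a b → T a b ≡ true → E a b ≡ true
  T⊆E a b p with T-edge (ab {a = a} {b} p)
  ... | inj₁ pa with parent-edge pa (λ ())
  ...   | ab q , _ = q
  T⊆E a b p | inj₂ pb with parent-edge pb (λ ())
  ...   | ba q , _ = q

  path-to-root : ∀ fuel v → rank v < fuel → Walk T v r
  path-to-root (suc fuel) v rank<fuel with v ≟ᵛ r
  ... | yes refl = here
  ... | no v≢r   = step (tree-link refl edge) (path-to-root fuel (parent v) (<-≤-trans down (≤-pred rank<fuel)))
    where
    edge = proj₁ (parent-step v v≢r)
    down = proj₂ (parent-step v v≢r)

  connected : Connected T
  connected u v = path-to-root _ u ≤-refl ▸ reverse-walk (path-to-root _ v ≤-refl)

  -- A non-backtracking walk whose first step goes from a vertex to a child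
  -- keeps going to children (a vertex has only one parent), so the rank
  -- strictly increases from its start to its end.
  ascending : ∀ x y zs w → Linked (Adj T) (x ∷ y ∷ zs ++ [ w ]) →
    NonBacktracking (x ∷ y ∷ zs ++ [ w ]) → parent y ≡ x → rank x < rank w
  ascending x y [] w (e₁ ∷ e₂ ∷ _) (x≢w , _) py with T-edge e₂
  ... | inj₁ py′ = ⊥-elim (x≢w (trans (sym py) py′))
  ... | inj₂ pw  = <-trans (up-rank (adj-sym e₁) py) (up-rank (adj-sym e₂) pw)
  ascending x y (z ∷ zs) w (e₁ ∷ l@(e₂ ∷ _)) (x≢z , nb) py with T-edge e₂
  ... | inj₁ py′ = ⊥-elim (x≢z (trans (sym py) py′))
  ... | inj₂ pz  = <-trans (up-rank (adj-sym e₁) py) (ascending y z zs w l nb pz)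

  -- Dually, if its last step goes from a vertex to its parent then every step
  -- does, and the rank strictly decreases from its start to its end.
  descending : ∀ x y zs w → Linked (Adj T) (x ∷ y ∷ zs ++ [ w ]) →
    NonBacktracking (x ∷ y ∷ zs ++ [ w ]) → parent (end y zs) ≡ w → parent x ≡ y × rank w < rank x
  descending x y [] w (e₁ ∷ e₂ ∷ _) (x≢w , _) pyw with T-edge e₁
  ... | inj₁ px  = px , <-trans (up-rank e₂ pyw) (up-rank e₁ px)
  ... | inj₂ pyx = ⊥-elim (x≢w (trans (sym pyx) pyw))
  descending x y (z ∷ zs) w (e₁ ∷ l) (x≢z , nb) pend with descending y z zs w l nb pend
  ... | pyz , w<y with T-edge e₁
  ...   | inj₁ px  = px , <-trans w<y (up-rank e₁ px)
  ...   | inj₂ pyx = ⊥-elim (x≢z (trans (sym pyx) pyz))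

  -- The closed walk v₀ v₁ … vₖ v₀ of a cycle either starts at v₀ with a step
  -- to a child (then rank v₀ < rank v₀), or with the step to its parent v₁; then
  -- the last step vₖ v₀ is not the parent step of v₀ (as vₖ ≠ v₁), so it is the
  -- parent step of vₖ, and again rank v₀ < rank v₀.
  acyclic : Acyclic T
  acyclic (v₀ , []         , ()      , _)
  acyclic (v₀ , _ ∷ []     , s≤s () , _)
  acyclic (v₀ , v₁ ∷ v₂ ∷ vs , _ , uniq@(_ ∷ (v₁≢ ∷ _)) , links@(e₀₁ ∷ links₁))
    with T-edge e₀₁
  ... | inj₂ p₁ = <-irrefl refl (ascending v₀ v₁ (v₂ ∷ vs) v₀ links (cycle-nonbacktracking uniq) p₁)
  ... | inj₁ p₀ with T-edge (last-link v₁ (v₂ ∷ vs) v₀ links₁)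
  ...   | inj₁ pₖ  = <-irrefl refl (proj₂ (descending v₀ v₁ (v₂ ∷ vs) v₀ links (cycle-nonbacktracking uniq) pₖ))
  ...   | inj₂ p₀′ = end-all v₂ vs v₁≢ (trans (sym p₀) p₀′)

  spanning-tree : IsSpanningTree T
  spanning-tree = connected , acyclic

-- The component of r in the spanning subgraph E is computed as the limit of
-- the layers {r} ⊆ expand {r} ⊆ expand² {r} ⊆ …; the sizes are bounded by
-- m + n, so some layer is closed under adjacency.  When the component is
-- everything, the first layer containing a vertex is a rank for which a
-- neighbour in the previous layer is a parent, giving a spanning tree T ⊆ E.

module Component {m n : ℕ} (E : EdgeSet m n) (r : Vertex m n) where

  VSet : Set
  VSet = Vertex m n → Bool

  touches? : (S : VSet) (v : Vertex m n) → Dec (∃ λ u → S u ≡ true × Adj E v u)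
  touches? S v = any-vertex? λ u → (S u ≟ᵇ true) ×-dec adj? E v u

  expand : VSet → VSet
  expand S v = S v ∨ does (touches? S v)

  expand-⊒ : ∀ S → S ⊑ expand S
  expand-⊒ S v Sv rewrite Sv = refl

  expand-neighbour : ∀ S {u v} → S u ≡ true → Adj E v u → expand S v ≡ true
  expand-neighbour S {u} {v} Su vu with S v
  ... | true  = refl
  ... | false = dec-true (touches? S v) (u , Su , vu)

  expand-witness : ∀ S v → expand S v ≡ true → S v ≡ false → ∃ λ u → S u ≡ true × Adj E v u
  expand-witness S v new Sv = does-sound (touches? S v) (subst (λ x → x ∨ does (touches? S v) ≡ true) Sv new)

  Closed : VSet → Set
  Closed S = ∀ v → expand S v ≡ true → S v ≡ true

  closed-or-grows : ∀ S → Closed S ⊎ size S < size (expand S)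
  closed-or-grows S with any-vertex? (λ v → (expand S v ≟ᵇ true) ×-dec (S v ≟ᵇ false))
  ... | yes (v , new , Sv) = inj₂ (size-grows (expand-⊒ S) v new Sv)
  ... | no none            = inj₁ λ v new → ¬-not λ Sv → none (v , new , Sv)

  -- layer i: the vertices within distance i of r.
  layer : ℕ → VSet
  layer zero    v = does (v ≟ᵛ r)
  layer (suc i) = expand (layer i)

  layer-root : ∀ i → layer i r ≡ true
  layer-root zero    = dec-true (r ≟ᵛ r) refl
  layer-root (suc i) = expand-⊒ (layer i) r (layer-root i)

  layer-mono : ∀ {l i} v → l ≤ i → layer l v ≡ true → layer i v ≡ true
  layer-mono {l} v l≤i v∈l = go (≤⇒≤′ l≤i)
    where
    go : ∀ {i} → l ≤′ i → layer i v ≡ true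
    go ≤′-refl        = v∈l
    go (≤′-step l≤i) = expand-⊒ _ v (go l≤i)

  closed-or-large : ∀ i → (∃ λ j → Closed (layer j)) ⊎ i ≤ size (layer i)
  closed-or-large zero = inj₂ z≤n
  closed-or-large (suc i) with closed-or-large i
  ... | inj₁ closed = inj₁ closed
  ... | inj₂ large with closed-or-grows (layer i)
  ...   | inj₁ closed = inj₁ (i , closed)
  ...   | inj₂ grows  = inj₂ (≤-<-trans large grows)

  -- Some layer is closed: otherwise layer (m + n + 1) would be too large.
  closed-layer : ∃ λ j → Closed (layer j)
  closed-layer with closed-or-large (suc (m + n))
  ... | inj₁ closed = closed
  ... | inj₂ large  = contradiction large (≤⇒≯ (size-≤ (layer (suc (m + n)))))

  stage : ℕ
  stage = proj₁ closed-layer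

  Comp : VSet
  Comp = layer stage

  comp-root : Comp r ≡ true
  comp-root = layer-root stage

  comp-closed : ∀ {u v} → Comp u ≡ true → Adj E u v → Comp v ≡ true
  comp-closed {u} {v} Cu uv = proj₂ closed-layer v (expand-neighbour Comp Cu (adj-sym uv))

  firstLayer : ℕ → Vertex m n → ℕ
  firstLayer zero    v = 0
  firstLayer (suc i) v = if layer i v then firstLayer i v else suc i

  firstLayer-member : ∀ i v → layer i v ≡ true → layer (firstLayer i v) v ≡ true
  firstLayer-member zero    v v∈ = v∈
  firstLayer-member (suc i) v v∈ with layer i v in v∈i
  ... | true  = firstLayer-member i v v∈i
  ... | false = subst (λ x → x ∨ does (touches? (layer i) v) ≡ true) (sym v∈i) v∈

  firstLayer-least : ∀ i v l → l < firstLayer i v → layer l v ≡ false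
  firstLayer-least (suc i) v l l< with layer i v in v∈i
  ... | true  = firstLayer-least i v l l<
  ... | false with layer l v in v∈l
  ...   | false = refl
  ...   | true  = contradiction (trans (sym (layer-mono v (≤-pred l<) v∈l)) v∈i) λ ()

  rank : Vertex m n → ℕ
  rank = firstLayer stage

  parentAt : ℕ → Vertex m n → Vertex m n
  parentAt zero    v = v
  parentAt (suc d) v with touches? (layer d) v
  ... | yes (u , _) = u
  ... | no _        = v

  parent : Vertex m n → Vertex m n
  parent v = parentAt (rank v) v

  parentAt-spec : ∀ d v → layer (suc d) v ≡ true → layer d v ≡ false →
    Adj E v (parentAt (suc d) v) × layer d (parentAt (suc d) v) ≡ true
  parentAt-spec d v new old = from-witness (expand-witness (layer d) v new old)
    where
    from-witness : (∃ λ u → layer d u ≡ true × Adj E v u) →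
      Adj E v (parentAt (suc d) v) × layer d (parentAt (suc d) v) ≡ true
    from-witness w with touches? (layer d) v
    ... | yes (u , u∈ , vu) = vu , u∈
    ... | no none           = ⊥-elim (none w)

  rank-≤ : ∀ {v l} → layer l v ≡ true → rank v ≤ l
  rank-≤ {v} {l} v∈l = ≮⇒≥ λ l<rank → contradiction (trans (sym v∈l) (firstLayer-least stage v l l<rank)) λ ()

  rank-root : rank r ≡ 0
  rank-root = n≤0⇒n≡0 (rank-≤ (layer-root 0))

  module _ (full : ∀ v → Comp v ≡ true) where

    rank-member : ∀ v → layer (rank v) v ≡ true
    rank-member v = firstLayer-member stage v (full v)

    parent-root : parent r ≡ r
    parent-root rewrite rank-root = refl

    parent-step : ∀ v → v ≢ r → Adj E v (parent v) × rank (parent v) < rank v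
    parent-step v v≢r with rank v in eq
    ... | zero  = ⊥-elim (v≢r (does-sound (v ≟ᵛ r) (subst (λ l → layer l v ≡ true) eq (rank-member v))))
    ... | suc d with parentAt-spec d v (subst (λ l → layer l v ≡ true) eq (rank-member v))
                                       (firstLayer-least stage v d (subst (d <_) (sym eq) ≤-refl))
    ...   | vu , u∈ = vu , s≤s (rank-≤ u∈)

    spanning-subtree : ∃[ T ] IsSpanningTree T × (∀ a b → T a b ≡ true → E a b ≡ true)
    spanning-subtree = F.T , F.spanning-tree , F.T⊆E
      where module F = ParentForest E r parent rank parent-root parent-step

colourEdges : ∀ {m n} → Colouring m n → Colour → EdgeSet m n
colourEdges c k a b = does (c a b ≟ᶜ k)

bool-ext : ∀ {x y} → (x ≡ true → y ≡ true) → (y ≡ true → x ≡ true) → x ≡ y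
bool-ext {true}  x⇒y _   = sym (x⇒y refl)
bool-ext {false} {false} _ _ = refl
bool-ext {false} {true}  _ y⇒x = y⇒x refl

distinct : ∀ {x y} → x ≡ true → y ≡ false → x ≢ y
distinct refl refl ()

module ColourComponent {m n : ℕ} (c : Colouring m n) (k : Colour) (r : Vertex m n) where

  private module C = Component (colourEdges c k) r
  open C public using (Comp; comp-root)

  reach-AB : ∀ {a b} → Comp (inj₁ a) ≡ true → c a b ≡ k → Comp (inj₂ b) ≡ true
  reach-AB {a} {b} a∈ ab-k = C.comp-closed a∈ (ab (dec-true (c a b ≟ᶜ k) ab-k))

  reach-BA : ∀ {a b} → Comp (inj₂ b) ≡ true → c a b ≡ k → Comp (inj₁ a) ≡ true
  reach-BA {a} {b} b∈ ab-k = C.comp-closed b∈ (ba (dec-true (c a b ≟ᶜ k) ab-k))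

  same-component : ∀ {a b} → c a b ≡ k → Comp (inj₁ a) ≡ Comp (inj₂ b)
  same-component ab-k = bool-ext (λ a∈ → reach-AB a∈ ab-k) (λ b∈ → reach-BA b∈ ab-k)

  monochromatic-tree : (∀ v → Comp v ≡ true) → HasMonochromaticSpanningTree c
  monochromatic-tree full with C.spanning-subtree full
  ... | T , tree , T⊆ = k , T , tree , λ a b p → does-sound (c a b ≟ᶜ k) (T⊆ a b p)

-- A vertex all of whose edges are green is the centre of a green spanning
-- tree, unless some vertex has only blue edges (S-type): then every vertex on
-- its side reaches the other side, which is joined to the centre, by green.
green-star : ∀ {m n} (c : Colouring m n) → ¬ SType c → ∀ v → AllIncident c green v →
  HasMonochromaticSpanningTree c
green-star c ¬S (inj₁ a₁) a₁-green = G.monochromatic-tree full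
  where
  module G = ColourComponent c green (inj₁ a₁)
  B-in : ∀ b → G.Comp (inj₂ b) ≡ true
  B-in b = G.reach-AB G.comp-root (a₁-green b)
  full : ∀ v → G.Comp v ≡ true
  full (inj₂ b) = B-in b
  full (inj₁ a) with some-green (c a) (λ a-blue → ¬S ((inj₁ a , a-blue) , (inj₁ a₁ , a₁-green)))
  ... | b , ab-green = G.reach-BA (B-in b) ab-green
green-star c ¬S (inj₂ b₁) b₁-green = G.monochromatic-tree full
  where
  module G = ColourComponent c green (inj₂ b₁)
  A-in : ∀ a → G.Comp (inj₁ a) ≡ true
  A-in a = G.reach-BA G.comp-root (b₁-green a)
  full : ∀ v → G.Comp v ≡ true
  full (inj₁ a) = A-in a
  full (inj₂ b) with some-green (λ a → c a b) (λ b-blue → ¬S ((inj₂ b , b-blue) , (inj₂ b₁ , b₁-green)))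
  ... | a , ab-green = G.reach-AB (A-in a) ab-green

module GreenCut {m n : ℕ} (c : Colouring m n) (ℓ : Vertex m n → Bool)
  (cut-green : ∀ a b → ℓ (inj₁ a) ≢ ℓ (inj₂ b) → c a b ≡ green)
  {a₀ a₁ : Fin m} (A-split : ℓ (inj₁ a₀) ≢ ℓ (inj₁ a₁))
  {b₀ b₁ : Fin n} (B-split : ℓ (inj₂ b₀) ≢ ℓ (inj₂ b₁)) where

  -- One green edge xy inside a label class connects everything by green:
  -- y reaches the A-vertices of the other label, x the B-vertices of the other
  -- label, and these in turn reach the rest of x's and y's class.
  green-edge-spans : ∀ x y → ℓ (inj₁ x) ≡ ℓ (inj₂ y) → c x y ≡ green → HasMonochromaticSpanningTree c
  green-edge-spans x y same xy-green = G.monochromatic-tree full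
    where
    module G = ColourComponent c green (inj₁ x)
    a′ = avoiding (ℓ ∘ inj₁) A-split (ℓ (inj₂ y))
    b′ = avoiding (ℓ ∘ inj₂) B-split (ℓ (inj₁ x))
    y-in : G.Comp (inj₂ y) ≡ true
    y-in = G.reach-AB G.comp-root xy-green
    a′-in : G.Comp (inj₁ (proj₁ a′)) ≡ true
    a′-in = G.reach-BA y-in (cut-green (proj₁ a′) y (proj₂ a′))
    b′-in : G.Comp (inj₂ (proj₁ b′)) ≡ true
    b′-in = G.reach-AB G.comp-root (cut-green x (proj₁ b′) λ eq → proj₂ b′ (sym eq))
    full : ∀ v → G.Comp v ≡ true
    full (inj₁ a) with ℓ (inj₁ a) ≟ᵇ ℓ (inj₂ y)
    ... | no ne  = G.reach-BA y-in (cut-green a y ne)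
    ... | yes eq = G.reach-BA b′-in (cut-green a (proj₁ b′) λ eq′ → proj₂ b′ (trans (sym eq′) (trans eq (sym same))))
    full (inj₂ b) with ℓ (inj₁ x) ≟ᵇ ℓ (inj₂ b)
    ... | no ne  = G.reach-AB G.comp-root (cut-green x b ne)
    ... | yes eq = G.reach-AB a′-in (cut-green (proj₁ a′) b λ eq′ → proj₂ a′ (trans eq′ (trans (sym eq) same)))

  M-type : (∀ a b → ℓ (inj₁ a) ≡ ℓ (inj₂ b) → c a b ≡ blue) → MType c
  M-type inside-blue =
    ℓ ∘ inj₁ , ℓ ∘ inj₂ ,
    labelled true A-split , labelled false A-split , labelled true B-split , labelled false B-split ,
    inside-blue , cut-green
    where
    labelled : ∀ p {I : Set} {f : I → Bool} {i j} → f i ≢ f j → ∃ λ k → f k ≡ p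
    labelled p {f = f} fi≢fj with avoiding f fi≢fj (not p)
    ... | k , fk≢¬p = k , trans (¬-not fk≢¬p) (not-involutive p)

module Sufficiency {m n : ℕ} (c : Colouring m n) (a₀ : Fin m) (¬S : ¬ SType c) (¬M : ¬ MType c) where

  module Blue = ColourComponent c blue (inj₁ a₀)

  inBlue : Vertex m n → Bool
  inBlue = Blue.Comp

  leaving-green : ∀ a b → inBlue (inj₁ a) ≢ inBlue (inj₂ b) → c a b ≡ green
  leaving-green a b ne = not-blue λ ab-blue → ne (Blue.same-component ab-blue)

  -- When the blue component contains vertices of A and of B but neither all of
  -- A nor all of B, both labels occur on both sides; a green edge inside a
  -- label class then spans, and otherwise the colouring is of M-type.
  both-sides-split : ∀ {a₁ b₀ b₁} → inBlue (inj₁ a₁) ≡ false → inBlue (inj₂ b₀) ≡ true →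
    inBlue (inj₂ b₁) ≡ false → HasMonochromaticSpanningTree c
  both-sides-split a₁-out b₀-in b₁-out = by-cases (any? λ x → any? λ y → green-inside? x y)
    where
    module Cut = GreenCut c inBlue leaving-green (distinct Blue.comp-root a₁-out) (distinct b₀-in b₁-out)
    green-inside? : ∀ x y → Dec (inBlue (inj₁ x) ≡ inBlue (inj₂ y) × c x y ≡ green)
    green-inside? x y = (inBlue (inj₁ x) ≟ᵇ inBlue (inj₂ y)) ×-dec (c x y ≟ᶜ green)
    by-cases : Dec (∃ λ x → ∃ λ y → inBlue (inj₁ x) ≡ inBlue (inj₂ y) × c x y ≡ green) →
      HasMonochromaticSpanningTree c
    by-cases (yes (x , y , same , xy-green)) = Cut.green-edge-spans x y same xy-green
    by-cases (no none) =
      ⊥-elim (¬M (Cut.M-type λ a b same → not-green λ ab-green → none (a , b , same , ab-green)))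

  spanning : HasMonochromaticSpanningTree c
  spanning with any? (λ a → inBlue (inj₁ a) ≟ᵇ false) | any? (λ b → inBlue (inj₂ b) ≟ᵇ false)
  ... | no A-in | no B-in =
    Blue.monochromatic-tree λ { (inj₁ a) → ¬-not λ out → A-in (a , out)
                              ; (inj₂ b) → ¬-not λ out → B-in (b , out) }
  ... | no A-in | yes (b₁ , b₁-out) =
    green-star c ¬S (inj₂ b₁) λ a →
      leaving-green a b₁ (distinct (¬-not λ out → A-in (a , out)) b₁-out)
  ... | yes (a₁ , a₁-out) | no B-in =
    green-star c ¬S (inj₁ a₁) λ b →
      leaving-green a₁ b λ eq → distinct (¬-not λ out → B-in (b , out)) a₁-out (sym eq)
  ... | yes (a₁ , a₁-out) | yes (b₁ , b₁-out) with any? (λ b → inBlue (inj₂ b) ≟ᵇ true)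
  ...   | no B-out =
    green-star c ¬S (inj₁ a₀) λ b →
      leaving-green a₀ b (distinct Blue.comp-root (¬-not λ b-in → B-out (b , b-in)))
  ...   | yes (b₀ , b₀-in) = both-sides-split a₁-out b₀-in b₁-out

has-neighbour : ∀ {m n} {T : EdgeSet m n} → Fin m → Fin n → Connected T → ∀ v → ∃ (Adj T v)
has-neighbour a₀ b₀ conn (inj₁ a) with conn (inj₁ a) (inj₂ b₀)
... | step e _ = _ , e
has-neighbour a₀ b₀ conn (inj₂ b) with conn (inj₂ b) (inj₁ a₀)
... | step e _ = _ , e

incident-colour : ∀ {m n} {c : Colouring m n} {k k′ T v u} → Monochromatic c k T →
  AllIncident c k′ v → Adj T v u → k′ ≡ k
incident-colour mono all-k′ (ab {b = b} p) = trans (sym (all-k′ b)) (mono _ b p)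
incident-colour mono all-k′ (ba {a = a} p) = trans (sym (all-k′ a)) (mono a _ p)

no-S-type : ∀ {m n} {c : Colouring m n} {k T} → Fin m → Fin n → Connected T →
  Monochromatic c k T → ¬ SType c
no-S-type {k = blue} a₀ b₀ conn mono (_ , (y , y-green))
  with incident-colour mono y-green (proj₂ (has-neighbour a₀ b₀ conn y))
... | ()
no-S-type {k = green} a₀ b₀ conn mono ((x , x-blue) , _)
  with incident-colour mono x-blue (proj₂ (has-neighbour a₀ b₀ conn x))
... | ()

-- The relation between the part labels of the ends of an edge of colour k in
-- an M-type partition: equal for blue, opposite for green.
twist : Colour → Bool → Bool
twist blue  x = x
twist green x = not x

-- Along a connected subgraph of colour k the labels pA on A and twist k ∘ pB
-- on B are constant, so A₁ and A₂ cannot both be nonempty.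
no-M-type : ∀ {m n} {c : Colouring m n} {k T} → Connected T → Monochromatic c k T → ¬ MType c
no-M-type {m} {n} {c} {k} {T} conn mono (pA , pB , (a₁ , a₁∈A₁) , (a₂ , a₂∈A₂) , _ , _ , same-blue , cross-green) =
  contradiction (walk-invariant ℓ ℓ-edge (conn (inj₁ a₁) (inj₁ a₂))) (distinct a₁∈A₁ a₂∈A₂)
  where
  ℓ : Vertex m n → Bool
  ℓ (inj₁ a) = pA a
  ℓ (inj₂ b) = twist k (pB b)
  edge-label : ∀ k′ a b → c a b ≡ k′ → pA a ≡ twist k′ (pB b)
  edge-label blue a b ab-blue with pA a ≟ᵇ pB b
  ... | yes eq = eq
  ... | no ne  = contradiction (trans (sym ab-blue) (cross-green a b ne)) λ ()
  edge-label green a b ab-green = ¬-not λ eq → contradiction (trans (sym ab-green) (same-blue a b eq)) λ ()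
  ℓ-edge : ∀ {u v} → Adj T u v → ℓ u ≡ ℓ v
  ℓ-edge (ab p) = edge-label k _ _ (mono _ _ p)
  ℓ-edge (ba p) = sym (edge-label k _ _ (mono _ _ p))

lemma1 : (m n : ℕ) → 1 ≤ m → 1 ≤ n → (c : Colouring m n) →
    HasMonochromaticSpanningTree c ⇔ (¬ SType c × ¬ MType c)
lemma1 (suc m) (suc n) _ _ c = mk⇔ necessity sufficiency
  where
  necessity : HasMonochromaticSpanningTree c → ¬ SType c × ¬ MType c
  necessity (k , T , (conn , _) , mono) = no-S-type zero zero conn mono , no-M-type conn mono
  sufficiency : ¬ SType c × ¬ MType c → HasMonochromaticSpanningTree c
  sufficiency (¬S , ¬M) = Sufficiency.spanning c zero ¬S ¬M
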